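{- The graph $H_1$ defined below is $3$-choosable.
   Context: $W_2$ is the graph on the $21$ vertices $u,v,w,x_1,x_2,x_3,x_4,p_1,\dots,p_5,y_1,y_2,y_3,y_4,q_1,\dots,q_5$ with the following edges: the $5$-cycles $w x_1 x_2 x_3 x_4 w$, $p_1p_2p_3p_4p_5p_1$, $w y_1 y_2 y_3 y_4 w$, $q_1q_2q_3q_4q_5q_1$; the edges $wp_1, x_1p_2, x_2p_3, x_3p_4, x_4p_5$ and $wq_1, y_1q_2, y_2q_3, y_3q_4, y_4q_5$; the edges $uw, ux_2, uy_2$; and the edges $vx_2, vx_4, vy_2, vy_4$. The graph $H_1$ is obtained by taking $6$ pairwise disjoint copies of $W_2$, identifying all $6$ copies of $u$ into a single vertex and all $6$ copies of $v$ into a single vertex. A graph $G=(V,E)$ is $k$-choosable if for every assignment of sets $S(z)\subseteq\mathbb{Z}$ with $|S(z)|=k$ for all $z\in V$, there is a proper coloring $c:V\to\mathbb{Z}$ with $c(z)\in S(z)$ for all $z$. -}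

module Defs where

open import Data.Nat using (ℕ)
open import Data.Fin using (Fin)
open import Data.Integer using (ℤ)
open import Data.List using (List; []; _∷_; length)
open import Data.List.Membership.Propositional using (_∈_)
open import Data.List.Relation.Unary.Unique.Propositional using (Unique)
open import Data.Product using (_×_; _,_; Σ; ∃)
open import Data.Sum using (_⊎_)
open import Relation.Binary.PropositionalEquality using (_≡_; _≢_)

record Graph : Set₁ where
  field
    V   : Set
    Adj : V → V → Set

open Graph public

-- List colourings and k-choosability.
-- A list assignment S gives every vertex a set of exactly k integers,
-- represented as a duplicate-free list of length k.

IsKList : ℕ → List ℤ → Set
IsKList k L = Unique L × length L ≡ k

IsProperListColouring : (G : Graph) → (V G → List ℤ) → (V G → ℤ) → Set
IsProperListColouring G S c =
  (∀ z → c z ∈ S z) × (∀ x y → Adj G x y → c x ≢ c y)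

Choosable : ℕ → Graph → Set
Choosable k G =
  (S : V G → List ℤ) → (∀ z → IsKList k (S z)) →
  Σ (V G → ℤ) λ c → IsProperListColouring G S c

data InnerV : Set where
  w' x1' x2' x3' x4' p1' p2' p3' p4' p5' y1' y2' y3' y4' q1' q2' q3' q4' q5' : InnerV

data W2V : Set where
  u v : W2V
  inn : InnerV → W2V

pattern w  = inn w'
pattern x1 = inn x1'
pattern x2 = inn x2'
pattern x3 = inn x3'
pattern x4 = inn x4'
pattern p1 = inn p1'
pattern p2 = inn p2'
pattern p3 = inn p3'
pattern p4 = inn p4'
pattern p5 = inn p5'
pattern y1 = inn y1'
pattern y2 = inn y2'
pattern y3 = inn y3'
pattern y4 = inn y4'
pattern q1 = inn q1'
pattern q2 = inn q2'
pattern q3 = inn q3'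
pattern q4 = inn q4'
pattern q5 = inn q5'

W2edges : List (W2V × W2V)
W2edges =
  (w , x1) ∷ (x1 , x2) ∷ (x2 , x3) ∷ (x3 , x4) ∷ (x4 , w) ∷
  (p1 , p2) ∷ (p2 , p3) ∷ (p3 , p4) ∷ (p4 , p5) ∷ (p5 , p1) ∷
  (w , y1) ∷ (y1 , y2) ∷ (y2 , y3) ∷ (y3 , y4) ∷ (y4 , w) ∷
  (q1 , q2) ∷ (q2 , q3) ∷ (q3 , q4) ∷ (q4 , q5) ∷ (q5 , q1) ∷
  (w , p1) ∷ (x1 , p2) ∷ (x2 , p3) ∷ (x3 , p4) ∷ (x4 , p5) ∷
  (w , q1) ∷ (y1 , q2) ∷ (y2 , q3) ∷ (y3 , q4) ∷ (y4 , q5) ∷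
  (u , w) ∷ (u , x2) ∷ (u , y2) ∷
  (v , x2) ∷ (v , x4) ∷ (v , y2) ∷ (v , y4) ∷ []

W2Adj : W2V → W2V → Set
W2Adj a b = ((a , b) ∈ W2edges) ⊎ ((b , a) ∈ W2edges)

W2 : Graph
W2 = record { V = W2V ; Adj = W2Adj }

-- The graph H₁: 6 disjoint copies of W₂ with all copies of u identified
-- and all copies of v identified.

data H1V : Set where
  hu : H1V
  hv : H1V
  copy : Fin 6 → InnerV → H1V

emb : Fin 6 → W2V → H1V
emb i u = hu
emb i v = hv
emb i (inn a) = copy i a

H1Adj : H1V → H1V → Set
H1Adj x y =
  ∃ λ (i : Fin 6) → ∃ λ a → ∃ λ b → W2Adj a b × emb i a ≡ x × emb i b ≡ y

H1 : Graph
H1 = record { V = H1V ; Adj = H1Adj }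

-- Fix colours a ∈ S(u) and b ∈ S(v). A copy of W₂ fails to extend them only if, for some colour c of w,
-- the half x₁…x₄, p₁…p₅ is rigid: the colours of x₁, x₂, x₄ are forced and then every vertex of the
-- 5-cycle p₁…p₅ is left with one and the same pair of colours. Such a rigid half determines a, b and c,
-- so each copy blocks at most one of the nine pairs (a, b); with only six copies some pair extends to all.
module Submission where

open import Defs
open import Data.Nat using (zero; suc)
open import Data.Nat.Properties using (_<?_)
open import Data.Fin using (Fin; zero; suc; remQuot; combine)
open import Data.Fin.Properties using (combine-remQuot; <⇒notInjective)
open import Data.Integer using (ℤ; _≟_)
open import Data.List using (List; []; _∷_)
open import Data.List.Membership.Propositional using (_∈_; _∉_; find; lose)
open import Data.List.Membership.DecPropositional _≟_ using (_∈?_)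
open import Data.List.Relation.Unary.Any using (here; there; any?)
open import Data.List.Relation.Unary.All as All using (All; []; _∷_)
open import Data.List.Relation.Unary.AllPairs using ([]; _∷_)
open import Data.Product using (Σ; ∃; _×_; _,_; proj₁; proj₂; uncurry)
open import Data.Sum using (_⊎_; inj₁; inj₂; swap; [_,_]′)
open import Data.Empty using (⊥-elim)
open import Function using (_∘_; id; case_of_)
open import Function.Definitions using (Injective)
open import Level using (0ℓ)
open import Relation.Nullary using (¬_; yes; no)
open import Relation.Nullary.Decidable using (¬?; _×-dec_; decidable-stable; from-yes)
open import Relation.Unary using (Pred; Decidable; _⊆_; _≐_)
open import Relation.Unary.Properties using (≐-trans)
open import Relation.Binary.PropositionalEquality
  using (_≡_; _≢_; refl; sym; cong; cong₂; subst; subst₂; ≢-sym; module ≡-Reasoning)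

private
  variable
    a a′ b b′ c c′ f f′ g p p′ q z : ℤ
    C L : List ℤ

infix 6 _∖_

_∖_ : List ℤ → ℤ → Pred ℤ 0ℓ
(C ∖ f) z = z ∈ C × z ≢ f

∖? : ∀ C f → Decidable (C ∖ f)
∖? C f z = z ∈? C ×-dec ¬? (z ≟ f)

Forced : List ℤ → ℤ → ℤ → ℤ → Set
Forced L p q g = ∀ {z} → (L ∖ p) z → z ≢ q → z ≡ g

≡-one-of : ¬ (z ≢ p × z ≢ q) → z ≡ p ⊎ z ≡ q
≡-one-of {z} {p} {q} neither with z ≟ p | z ≟ q
... | yes z≡p | _       = inj₁ z≡p
... | no _    | yes z≡q = inj₂ z≡q
... | no z≢p  | no z≢q  = ⊥-elim (neither (z≢p , z≢q))

witness-or-none : {P : Pred ℤ 0ℓ} → Decidable P → ∀ L →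
                  (∃ λ z → z ∈ L × P z) ⊎ (∀ {z} → z ∈ L → ¬ P z)
witness-or-none P? L with any? P? L
... | yes some = inj₁ (find some)
... | no none  = inj₂ (λ z∈L Pz → none (lose z∈L Pz))

three-list-⊈-pair : IsKList 3 L → ¬ (∀ {z} → z ∈ L → z ≡ p ⊎ z ≡ q)
three-list-⊈-pair {x ∷ y ∷ z ∷ []} ((x≢y ∷ x≢z ∷ []) ∷ (y≢z ∷ []) ∷ [] ∷ [] , refl) ⊆pq
  with ⊆pq (here refl) | ⊆pq (there (here refl)) | ⊆pq (there (there (here refl)))
... | inj₁ refl | inj₁ refl | _         = x≢y refl
... | inj₂ refl | inj₂ refl | _         = x≢y refl
... | inj₁ refl | _         | inj₁ refl = x≢z refl
... | inj₂ refl | _         | inj₂ refl = x≢z refl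
... | _         | inj₁ refl | inj₁ refl = y≢z refl
... | _         | inj₂ refl | inj₂ refl = y≢z refl

avoid-two : IsKList 3 L → ∀ p q → ∃ λ k → (L ∖ p) k × k ≢ q
avoid-two {L} three p q with witness-or-none (λ k → ¬? (k ≟ p) ×-dec ¬? (k ≟ q)) L
... | inj₁ (k , k∈L , k≢p , k≢q) = k , (k∈L , k≢p) , k≢q
... | inj₂ none = ⊥-elim (three-list-⊈-pair three (λ z∈L → ≡-one-of (none z∈L)))

forced? : ∀ L p q g → Forced L p q g ⊎ ∃ λ k → (L ∖ p) k × k ≢ q × k ≢ g
forced? L p q g with witness-or-none (λ k → ¬? (k ≟ p) ×-dec ¬? (k ≟ q) ×-dec ¬? (k ≟ g)) L
... | inj₁ (k , k∈L , k≢p , k≢q , k≢g) = inj₂ (k , (k∈L , k≢p) , k≢q , k≢g)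
... | inj₂ none = inj₁ λ {z} (z∈L , z≢p) z≢q →
  decidable-stable (z ≟ g) (λ z≢g → none z∈L (z≢p , z≢q , z≢g))

forced⇒≢ : IsKList 3 L → Forced L p q g → p ≢ q
forced⇒≢ three forced refl = three-list-⊈-pair three λ z∈L →
  ≡-one-of λ (z≢p , z≢g) → z≢g (forced (z∈L , z≢p) z≢p)

forced-unique : IsKList 3 L → Forced L p q g → Forced L p′ q g → p ≡ p′
forced-unique {L = L} {p = p} {q = q} {g = g} {p′ = p′} three forced forced′ =
  decidable-stable (p ≟ p′) λ p≢p′ → three-list-⊈-pair three λ z∈L →
    ≡-one-of λ (z≢q , z≢g) → z≢g (off-q-is-g z∈L z≢q p≢p′)
  where
  off-q-is-g : ∀ {z} → z ∈ L → z ≢ q → p ≢ p′ → z ≡ g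
  off-q-is-g {z} z∈L z≢q p≢p′ with z ≟ p
  ... | yes refl = forced′ (z∈L , p≢p′) z≢q
  ... | no z≢p   = forced (z∈L , z≢p) z≢q

⊆? : ∀ C f C′ f′ → C ∖ f ⊆ C′ ∖ f′ ⊎ ∃ λ z → (C ∖ f) z × ¬ (C′ ∖ f′) z
⊆? C f C′ f′ with witness-or-none (λ z → ¬? (z ≟ f) ×-dec ¬? (∖? C′ f′ z)) C
... | inj₁ (z , z∈C , z≢f , escapes) = inj₂ (z , (z∈C , z≢f) , escapes)
... | inj₂ none = inj₁ λ {z} (z∈C , z≢f) →
  decidable-stable (∖? C′ f′ z) (λ escapes → none z∈C (z≢f , escapes))

≐-forbidden-unique : {D : Pred ℤ 0ℓ} → f′ ∈ C → D ≐ C ∖ f → D ≐ C ∖ f′ → f ≡ f′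
≐-forbidden-unique {f′ = f′} {C = C} {f = f} f′∈C (_ , C∖f⊆D) (D⊆C∖f′ , _) =
  decidable-stable (f ≟ f′) λ f≢f′ → proj₂ (D⊆C∖f′ (C∖f⊆D (f′∈C , ≢-sym f≢f′))) refl

record CycleColouring (C₁ C₂ C₃ C₄ C₅ : List ℤ) (f₁ f₂ f₃ f₄ f₅ : ℤ) : Set where
  field
    r₁ r₂ r₃ r₄ r₅ : ℤ
    r₁∈ : (C₁ ∖ f₁) r₁
    r₂∈ : (C₂ ∖ f₂) r₂
    r₃∈ : (C₃ ∖ f₃) r₃
    r₄∈ : (C₄ ∖ f₄) r₄
    r₅∈ : (C₅ ∖ f₅) r₅
    r₁≢r₂ : r₁ ≢ r₂
    r₂≢r₃ : r₂ ≢ r₃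
    r₃≢r₄ : r₃ ≢ r₄
    r₄≢r₅ : r₄ ≢ r₅
    r₅≢r₁ : r₅ ≢ r₁

-- The five sets of available colours all equal one 2-set, from which an odd cycle cannot be coloured.
record RigidCycle (C₁ C₂ C₃ C₄ C₅ : List ℤ) (f₁ f₂ f₃ f₄ f₅ : ℤ) : Set where
  field
    f₁∈C₁ : f₁ ∈ C₁
    f₂∈C₂ : f₂ ∈ C₂
    f₃∈C₃ : f₃ ∈ C₃
    f₄∈C₄ : f₄ ∈ C₄
    f₅∈C₅ : f₅ ∈ C₅
    ≐₂ : C₁ ∖ f₁ ≐ C₂ ∖ f₂
    ≐₃ : C₁ ∖ f₁ ≐ C₃ ∖ f₃
    ≐₄ : C₁ ∖ f₁ ≐ C₄ ∖ f₄
    ≐₅ : C₁ ∖ f₁ ≐ C₅ ∖ f₅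

module _ {C₁ C₂ C₃ C₄ C₅ : List ℤ} {f₁ f₂ f₃ f₄ f₅ : ℤ} where

  rotate : CycleColouring C₂ C₃ C₄ C₅ C₁ f₂ f₃ f₄ f₅ f₁ →
           CycleColouring C₁ C₂ C₃ C₄ C₅ f₁ f₂ f₃ f₄ f₅
  rotate κ = record
    { r₁ = r₅ ; r₂ = r₁ ; r₃ = r₂ ; r₄ = r₃ ; r₅ = r₄
    ; r₁∈ = r₅∈ ; r₂∈ = r₁∈ ; r₃∈ = r₂∈ ; r₄∈ = r₃∈ ; r₅∈ = r₄∈
    ; r₁≢r₂ = r₅≢r₁ ; r₂≢r₃ = r₁≢r₂ ; r₃≢r₄ = r₂≢r₃ ; r₄≢r₅ = r₃≢r₄ ; r₅≢r₁ = r₄≢r₅ }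
    where open CycleColouring κ

  reflect : CycleColouring C₁ C₅ C₄ C₃ C₂ f₁ f₅ f₄ f₃ f₂ →
            CycleColouring C₁ C₂ C₃ C₄ C₅ f₁ f₂ f₃ f₄ f₅
  reflect κ = record
    { r₁ = r₁ ; r₂ = r₅ ; r₃ = r₄ ; r₄ = r₃ ; r₅ = r₂
    ; r₁∈ = r₁∈ ; r₂∈ = r₅∈ ; r₃∈ = r₄∈ ; r₄∈ = r₃∈ ; r₅∈ = r₂∈
    ; r₁≢r₂ = ≢-sym r₅≢r₁ ; r₂≢r₃ = ≢-sym r₄≢r₅ ; r₃≢r₄ = ≢-sym r₃≢r₄
    ; r₄≢r₅ = ≢-sym r₂≢r₃ ; r₅≢r₁ = ≢-sym r₁≢r₂ }
    where open CycleColouring κ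

  -- Colour greedily from vertex 2 on; vertex 1 comes last and is not restricted by f₁.
  colouring-if-absent : IsKList 3 C₁ → IsKList 3 C₂ → IsKList 3 C₃ → IsKList 3 C₄ → IsKList 3 C₅ →
                        f₁ ∉ C₁ → CycleColouring C₁ C₂ C₃ C₄ C₅ f₁ f₂ f₃ f₄ f₅
  colouring-if-absent k₁ k₂ k₃ k₄ k₅ f₁∉C₁ =
    let r₂ , r₂∈ , _     = avoid-two k₂ f₂ f₂
        r₃ , r₃∈ , r₃≢r₂ = avoid-two k₃ f₃ r₂
        r₄ , r₄∈ , r₄≢r₃ = avoid-two k₄ f₄ r₃
        r₅ , r₅∈ , r₅≢r₄ = avoid-two k₅ f₅ r₄
        r₁ , (r₁∈C₁ , r₁≢r₂) , r₁≢r₅ = avoid-two k₁ r₂ r₅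
    in record
      { r₁ = r₁ ; r₂ = r₂ ; r₃ = r₃ ; r₄ = r₄ ; r₅ = r₅
      ; r₁∈ = r₁∈C₁ , (λ r₁≡f₁ → f₁∉C₁ (subst (_∈ C₁) r₁≡f₁ r₁∈C₁))
      ; r₂∈ = r₂∈ ; r₃∈ = r₃∈ ; r₄∈ = r₄∈ ; r₅∈ = r₅∈
      ; r₁≢r₂ = r₁≢r₂ ; r₂≢r₃ = ≢-sym r₃≢r₂ ; r₃≢r₄ = ≢-sym r₄≢r₃
      ; r₄≢r₅ = ≢-sym r₅≢r₄ ; r₅≢r₁ = ≢-sym r₁≢r₅ }

  -- Give vertex 1 a colour that vertex 2 cannot use anyway, then colour greedily backwards from vertex 5.
  colouring-if-escape : IsKList 3 C₂ → IsKList 3 C₃ → IsKList 3 C₄ → IsKList 3 C₅ →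
                        (∃ λ z → (C₁ ∖ f₁) z × ¬ (C₂ ∖ f₂) z) →
                        CycleColouring C₁ C₂ C₃ C₄ C₅ f₁ f₂ f₃ f₄ f₅
  colouring-if-escape k₂ k₃ k₄ k₅ (z , z∈ , z∉) =
    let r₅ , r₅∈ , r₅≢z  = avoid-two k₅ f₅ z
        r₄ , r₄∈ , r₄≢r₅ = avoid-two k₄ f₄ r₅
        r₃ , r₃∈ , r₃≢r₄ = avoid-two k₃ f₃ r₄
        r₂ , r₂∈ , r₂≢r₃ = avoid-two k₂ f₂ r₃
    in record
      { r₁ = z ; r₂ = r₂ ; r₃ = r₃ ; r₄ = r₄ ; r₅ = r₅
      ; r₁∈ = z∈ ; r₂∈ = r₂∈ ; r₃∈ = r₃∈ ; r₄∈ = r₄∈ ; r₅∈ = r₅∈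
      ; r₁≢r₂ = λ z≡r₂ → z∉ (subst (C₂ ∖ f₂) (sym z≡r₂) r₂∈)
      ; r₂≢r₃ = r₂≢r₃ ; r₃≢r₄ = r₃≢r₄ ; r₄≢r₅ = r₄≢r₅ ; r₅≢r₁ = r₅≢z }

cycle-colouring-or-rigid :
  {C₁ C₂ C₃ C₄ C₅ : List ℤ} {f₁ f₂ f₃ f₄ f₅ : ℤ} →
  IsKList 3 C₁ → IsKList 3 C₂ → IsKList 3 C₃ → IsKList 3 C₄ → IsKList 3 C₅ →
  CycleColouring C₁ C₂ C₃ C₄ C₅ f₁ f₂ f₃ f₄ f₅ ⊎ RigidCycle C₁ C₂ C₃ C₄ C₅ f₁ f₂ f₃ f₄ f₅
cycle-colouring-or-rigid {C₁} {C₂} {C₃} {C₄} {C₅} {f₁} {f₂} {f₃} {f₄} {f₅} k₁ k₂ k₃ k₄ k₅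
  with f₁ ∈? C₁
... | no ∉ = inj₁ (colouring-if-absent k₁ k₂ k₃ k₄ k₅ ∉)
... | yes f₁∈C₁ with f₂ ∈? C₂
... | no ∉ = inj₁ (rotate (colouring-if-absent k₂ k₃ k₄ k₅ k₁ ∉))
... | yes f₂∈C₂ with f₃ ∈? C₃
... | no ∉ = inj₁ (rotate (rotate (colouring-if-absent k₃ k₄ k₅ k₁ k₂ ∉)))
... | yes f₃∈C₃ with f₄ ∈? C₄
... | no ∉ = inj₁ (rotate (rotate (rotate (colouring-if-absent k₄ k₅ k₁ k₂ k₃ ∉))))
... | yes f₄∈C₄ with f₅ ∈? C₅
... | no ∉ = inj₁ (rotate (rotate (rotate (rotate (colouring-if-absent k₅ k₁ k₂ k₃ k₄ ∉)))))
... | yes f₅∈C₅ with ⊆? C₁ f₁ C₂ f₂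
... | inj₂ e = inj₁ (colouring-if-escape k₂ k₃ k₄ k₅ e)
... | inj₁ ⊆₁₂ with ⊆? C₂ f₂ C₃ f₃
... | inj₂ e = inj₁ (rotate (colouring-if-escape k₃ k₄ k₅ k₁ e))
... | inj₁ ⊆₂₃ with ⊆? C₃ f₃ C₄ f₄
... | inj₂ e = inj₁ (rotate (rotate (colouring-if-escape k₄ k₅ k₁ k₂ e)))
... | inj₁ ⊆₃₄ with ⊆? C₄ f₄ C₅ f₅
... | inj₂ e = inj₁ (rotate (rotate (rotate (colouring-if-escape k₅ k₁ k₂ k₃ e))))
... | inj₁ ⊆₄₅ with ⊆? C₅ f₅ C₁ f₁
... | inj₂ e = inj₁ (rotate (rotate (rotate (rotate (colouring-if-escape k₁ k₂ k₃ k₄ e)))))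
... | inj₁ ⊆₅₁ with ⊆? C₁ f₁ C₅ f₅
... | inj₂ e = inj₁ (reflect (colouring-if-escape k₅ k₄ k₃ k₂ e))
... | inj₁ ⊆₁₅ with ⊆? C₂ f₂ C₁ f₁
... | inj₂ e = inj₁ (rotate (reflect (colouring-if-escape k₁ k₅ k₄ k₃ e)))
... | inj₁ ⊆₂₁ with ⊆? C₃ f₃ C₂ f₂
... | inj₂ e = inj₁ (rotate (rotate (reflect (colouring-if-escape k₂ k₁ k₅ k₄ e))))
... | inj₁ ⊆₃₂ with ⊆? C₄ f₄ C₃ f₃
... | inj₂ e = inj₁ (rotate (rotate (rotate (reflect (colouring-if-escape k₃ k₂ k₁ k₅ e)))))
... | inj₁ ⊆₄₃ with ⊆? C₅ f₅ C₄ f₄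
... | inj₂ e = inj₁ (rotate (rotate (rotate (rotate (reflect (colouring-if-escape k₄ k₃ k₂ k₁ e))))))
... | inj₁ ⊆₅₄ = inj₂ record
  { f₁∈C₁ = f₁∈C₁ ; f₂∈C₂ = f₂∈C₂ ; f₃∈C₃ = f₃∈C₃ ; f₄∈C₄ = f₄∈C₄ ; f₅∈C₅ = f₅∈C₅
  ; ≐₂ = ≐₂ ; ≐₃ = ≐-trans ≐₂ (⊆₂₃ , ⊆₃₂) ; ≐₄ = ≐-trans ≐₅ (⊆₅₄ , ⊆₄₅) ; ≐₅ = ≐₅ }
  where
  ≐₂ : C₁ ∖ f₁ ≐ C₂ ∖ f₂
  ≐₂ = ⊆₁₂ , ⊆₂₁
  ≐₅ : C₁ ∖ f₁ ≐ C₅ ∖ f₅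
  ≐₅ = ⊆₁₅ , ⊆₅₁

-- One half of W₂: the path x₁x₂x₃x₄ and the 5-cycle p₁…p₅ attached to w x₁ x₂ x₃ x₄.
-- Its outside neighbours are u (of x₂), v (of x₂ and x₄) and w (of x₁, x₄ and p₁), coloured a, b, c.
data WingV : Set where
  x₁ x₂ x₃ x₄ p₁ p₂ p₃ p₄ p₅ : WingV

module Wing (L : WingV → List ℤ) (three : ∀ t → IsKList 3 (L t)) where

  record Path (a b c : ℤ) : Set where
    field
      k₁ k₂ k₃ k₄ : ℤ
      k₁∈ : (L x₁ ∖ c) k₁
      k₁≢k₂ : k₁ ≢ k₂
      k₂∈ : (L x₂ ∖ a) k₂
      k₂≢b : k₂ ≢ b
      k₃∈ : (L x₃ ∖ k₂) k₃
      k₃≢k₄ : k₃ ≢ k₄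
      k₄∈ : (L x₄ ∖ b) k₄
      k₄≢c : k₄ ≢ c

  module _ {a b c : ℤ} (π : Path a b c) where
    open Path π

    Completion : Set
    Completion = CycleColouring (L p₁) (L p₂) (L p₃) (L p₄) (L p₅) c k₁ k₂ k₃ k₄

    RigidOver : Set
    RigidOver = RigidCycle (L p₁) (L p₂) (L p₃) (L p₄) (L p₅) c k₁ k₂ k₃ k₄

  record Colouring (a b c : ℤ) : Set where
    field
      path : Path a b c
      completion : Completion path
    open Path path public
    open CycleColouring completion public

  record Rigid (a b c : ℤ) : Set where
    field
      path : Path a b c
    open Path path public
    field
      forced₁ : Forced (L x₁) c k₂ k₁
      forced₂ : Forced (L x₂) a b k₂
      forced₄ : Forced (L x₄) b c k₄
      rigid : RigidOver path
    open RigidCycle rigid public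

  path-through : ∀ {a b c k₂ k₄} → (L x₂ ∖ a) k₂ → k₂ ≢ b → (L x₄ ∖ b) k₄ → k₄ ≢ c → Path a b c
  path-through {c = c} {k₂} {k₄} k₂∈ k₂≢b k₄∈ k₄≢c =
    let k₁ , k₁∈ , k₁≢k₂ = avoid-two (three x₁) c k₂
        k₃ , k₃∈ , k₃≢k₄ = avoid-two (three x₃) k₂ k₄
    in record { k₁∈ = k₁∈ ; k₁≢k₂ = k₁≢k₂ ; k₂∈ = k₂∈ ; k₂≢b = k₂≢b
              ; k₃∈ = k₃∈ ; k₃≢k₄ = k₃≢k₄ ; k₄∈ = k₄∈ ; k₄≢c = k₄≢c }

  complete-or-rigid : (π : Path a b c) → Completion π ⊎ RigidOver π
  complete-or-rigid π = cycle-colouring-or-rigid (three p₁) (three p₂) (three p₃) (three p₄) (three p₅)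

  colouring-unless-rigid : (π : Path a b c) → ¬ RigidOver π → Colouring a b c
  colouring-unless-rigid π ¬rigid with complete-or-rigid π
  ... | inj₁ κ = record { path = π ; completion = κ }
  ... | inj₂ ρ = ⊥-elim (¬rigid ρ)

  -- If one of x₁, x₂, x₄ has another admissible colour, recolouring it cannot leave the cycle rigid:
  -- two rigid cycles with the same colour at w forbid the same colour at every vertex.
  module _ {a b c : ℤ} (π : Path a b c) where
    open Path π
    open RigidCycle using (f₂∈C₂; f₃∈C₃; f₅∈C₅; ≐₂; ≐₃; ≐₅)

    colouring-or-rigid-from : Colouring a b c ⊎ Rigid a b c
    colouring-or-rigid-from with complete-or-rigid π
    ... | inj₁ κ = inj₁ (record { path = π ; completion = κ })
    ... | inj₂ ρ with forced? (L x₁) c k₂ k₁ | forced? (L x₂) a b k₂ | forced? (L x₄) b c k₄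
    ...   | inj₁ forced₁ | inj₁ forced₂ | inj₁ forced₄ = inj₂ record
      { path = π ; forced₁ = forced₁ ; forced₂ = forced₂ ; forced₄ = forced₄ ; rigid = ρ }
    ...   | inj₂ (k , k∈ , k≢k₂ , k≢k₁) | _ | _ = inj₁ (colouring-unless-rigid
      (record π { k₁ = k ; k₁∈ = k∈ ; k₁≢k₂ = k≢k₂ })
      λ ρ′ → k≢k₁ (≐-forbidden-unique (f₂∈C₂ ρ) (≐₂ ρ′) (≐₂ ρ)))
    ...   | _ | inj₂ (k , k∈ , k≢b , k≢k₂) | _ = inj₁ (colouring-unless-rigid
      (path-through k∈ k≢b k₄∈ k₄≢c)
      λ ρ′ → k≢k₂ (≐-forbidden-unique (f₃∈C₃ ρ) (≐₃ ρ′) (≐₃ ρ)))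
    ...   | _ | _ | inj₂ (k , k∈ , k≢c , k≢k₄) = inj₁ (colouring-unless-rigid
      (path-through k₂∈ k₂≢b k∈ k≢c)
      λ ρ′ → k≢k₄ (≐-forbidden-unique (f₅∈C₅ ρ) (≐₅ ρ′) (≐₅ ρ)))

  colouring-or-rigid : ∀ a b c → Colouring a b c ⊎ Rigid a b c
  colouring-or-rigid a b c =
    let k₂ , k₂∈ , k₂≢b = avoid-two (three x₂) a b
        k₄ , k₄∈ , k₄≢c = avoid-two (three x₄) b c
    in colouring-or-rigid-from (path-through k₂∈ k₂≢b k₄∈ k₄≢c)

  rigid-w-unique : Rigid a b c → Rigid a′ b′ c′ → c ≡ c′
  -- If c ≠ c′, then c is available at p₁ for ρ′, hence at p₃; for ρ it is not available at p₁,
  -- so c is the colour of x₂ in ρ, and then x₁ would have only two colours.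
  rigid-w-unique {c = c} {c′ = c′} ρ ρ′ = decidable-stable (c ≟ c′) λ c≢c′ →
    let c∈C₃ , _ = proj₁ ρ′.≐₃ (ρ.f₁∈C₁ , c≢c′)
    in case c ≟ ρ.k₂ of λ where
         (yes c≡k₂) → forced⇒≢ (three x₁) ρ.forced₁ c≡k₂
         (no c≢k₂)  → proj₂ (proj₂ ρ.≐₃ (c∈C₃ , c≢k₂)) refl
    where
    module ρ = Rigid ρ
    module ρ′ = Rigid ρ′

  rigid-uv-unique : Rigid a b c → Rigid a′ b′ c′ → a ≡ a′ × b ≡ b′
  rigid-uv-unique {a = a} {b = b} {a′ = a′} {b′ = b′} ρ ρ′ with refl ← rigid-w-unique ρ ρ′ = a≡a′ , b≡b′
    where
    module ρ = Rigid ρ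
    module ρ′ = Rigid ρ′
    k₂≡k₂′ : ρ.k₂ ≡ ρ′.k₂
    k₂≡k₂′ = ≐-forbidden-unique ρ′.f₃∈C₃ ρ.≐₃ ρ′.≐₃
    k₄≡k₄′ : ρ.k₄ ≡ ρ′.k₄
    k₄≡k₄′ = ≐-forbidden-unique ρ′.f₅∈C₅ ρ.≐₅ ρ′.≐₅
    b≡b′ : b ≡ b′
    b≡b′ = forced-unique (three x₄) ρ.forced₄ (subst (Forced (L x₄) _ _) (sym k₄≡k₄′) ρ′.forced₄)
    a≡a′ : a ≡ a′
    a≡a′ = forced-unique (three x₂) ρ.forced₂ (subst₂ (Forced (L x₂) _) (sym b≡b′) (sym k₂≡k₂′) ρ′.forced₂)

xWing yWing : WingV → InnerV
xWing x₁ = x1'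
xWing x₂ = x2'
xWing x₃ = x3'
xWing x₄ = x4'
xWing p₁ = p1'
xWing p₂ = p2'
xWing p₃ = p3'
xWing p₄ = p4'
xWing p₅ = p5'
yWing x₁ = y1'
yWing x₂ = y2'
yWing x₃ = y3'
yWing x₄ = y4'
yWing p₁ = q1'
yWing p₂ = q2'
yWing p₃ = q3'
yWing p₄ = q4'
yWing p₅ = q5'

extend : ℤ → ℤ → (InnerV → ℤ) → W2V → ℤ
extend a b κ u = a
extend a b κ v = b
extend a b κ (inn z) = κ z

record Extension (L : InnerV → List ℤ) (a b : ℤ) : Set where
  field
    colour : InnerV → ℤ
    colour∈ : ∀ z → colour z ∈ L z
    proper : ∀ s t → W2Adj s t → extend a b colour s ≢ extend a b colour t

module W₂ (L : InnerV → List ℤ) (three : ∀ z → IsKList 3 (L z)) where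
  module X = Wing (L ∘ xWing) (three ∘ xWing)
  module Y = Wing (L ∘ yWing) (three ∘ yWing)

  Blocked : ℤ → ℤ → Set
  Blocked a b = ∃ (X.Rigid a b)

  glue : (L w' ∖ a) c → X.Colouring a b c → Y.Colouring a b c → Extension L a b
  glue {a = a} {c = c} {b = b} (c∈ , c≢a) ξ η =
    record { colour = colour ; colour∈ = colour∈ ; proper = proper }
    where
    module ξ = X.Colouring ξ
    module η = Y.Colouring η

    colour : InnerV → ℤ
    colour w'  = c
    colour x1' = ξ.k₁
    colour x2' = ξ.k₂
    colour x3' = ξ.k₃
    colour x4' = ξ.k₄
    colour p1' = ξ.r₁
    colour p2' = ξ.r₂
    colour p3' = ξ.r₃
    colour p4' = ξ.r₄
    colour p5' = ξ.r₅
    colour y1' = η.k₁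
    colour y2' = η.k₂
    colour y3' = η.k₃
    colour y4' = η.k₄
    colour q1' = η.r₁
    colour q2' = η.r₂
    colour q3' = η.r₃
    colour q4' = η.r₄
    colour q5' = η.r₅

    colour∈ : ∀ z → colour z ∈ L z
    colour∈ w'  = c∈
    colour∈ x1' = proj₁ ξ.k₁∈
    colour∈ x2' = proj₁ ξ.k₂∈
    colour∈ x3' = proj₁ ξ.k₃∈
    colour∈ x4' = proj₁ ξ.k₄∈
    colour∈ p1' = proj₁ ξ.r₁∈
    colour∈ p2' = proj₁ ξ.r₂∈
    colour∈ p3' = proj₁ ξ.r₃∈
    colour∈ p4' = proj₁ ξ.r₄∈
    colour∈ p5' = proj₁ ξ.r₅∈
    colour∈ y1' = proj₁ η.k₁∈
    colour∈ y2' = proj₁ η.k₂∈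
    colour∈ y3' = proj₁ η.k₃∈
    colour∈ y4' = proj₁ η.k₄∈
    colour∈ q1' = proj₁ η.r₁∈
    colour∈ q2' = proj₁ η.r₂∈
    colour∈ q3' = proj₁ η.r₃∈
    colour∈ q4' = proj₁ η.r₄∈
    colour∈ q5' = proj₁ η.r₅∈

    separated : All (λ e → extend a b colour (proj₁ e) ≢ extend a b colour (proj₂ e)) W2edges
    separated =
      ≢-sym (proj₂ ξ.k₁∈) ∷ ξ.k₁≢k₂ ∷ ≢-sym (proj₂ ξ.k₃∈) ∷ ξ.k₃≢k₄ ∷ ξ.k₄≢c ∷
      ξ.r₁≢r₂ ∷ ξ.r₂≢r₃ ∷ ξ.r₃≢r₄ ∷ ξ.r₄≢r₅ ∷ ξ.r₅≢r₁ ∷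
      ≢-sym (proj₂ η.k₁∈) ∷ η.k₁≢k₂ ∷ ≢-sym (proj₂ η.k₃∈) ∷ η.k₃≢k₄ ∷ η.k₄≢c ∷
      η.r₁≢r₂ ∷ η.r₂≢r₃ ∷ η.r₃≢r₄ ∷ η.r₄≢r₅ ∷ η.r₅≢r₁ ∷
      ≢-sym (proj₂ ξ.r₁∈) ∷ ≢-sym (proj₂ ξ.r₂∈) ∷ ≢-sym (proj₂ ξ.r₃∈) ∷
      ≢-sym (proj₂ ξ.r₄∈) ∷ ≢-sym (proj₂ ξ.r₅∈) ∷
      ≢-sym (proj₂ η.r₁∈) ∷ ≢-sym (proj₂ η.r₂∈) ∷ ≢-sym (proj₂ η.r₃∈) ∷
      ≢-sym (proj₂ η.r₄∈) ∷ ≢-sym (proj₂ η.r₅∈) ∷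
      ≢-sym c≢a ∷ ≢-sym (proj₂ ξ.k₂∈) ∷ ≢-sym (proj₂ η.k₂∈) ∷
      ≢-sym ξ.k₂≢b ∷ ≢-sym (proj₂ ξ.k₄∈) ∷ ≢-sym η.k₂≢b ∷ ≢-sym (proj₂ η.k₄∈) ∷ []

    proper : ∀ s t → W2Adj s t → extend a b colour s ≢ extend a b colour t
    proper s t (inj₁ st) = All.lookup separated st
    proper s t (inj₂ ts) = ≢-sym (All.lookup separated ts)

  -- Two colours c₁ ≠ c₂ for w: the y-half cannot be rigid for both, as rigidity determines c.
  extension-or-blocked : ∀ a b → Extension L a b ⊎ Blocked a b
  extension-or-blocked a b with avoid-two (three w') a a
  ... | c₁ , c₁∈ , _ with avoid-two (three w') a c₁
  ... | c₂ , c₂∈ , c₂≢c₁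
    with X.colouring-or-rigid a b c₁ | Y.colouring-or-rigid a b c₁
       | X.colouring-or-rigid a b c₂ | Y.colouring-or-rigid a b c₂
  ... | inj₂ ρ  | _       | _       | _       = inj₂ (c₁ , ρ)
  ... | inj₁ ξ  | inj₁ η  | _       | _       = inj₁ (glue c₁∈ ξ η)
  ... | inj₁ _  | inj₂ _  | inj₂ ρ  | _       = inj₂ (c₂ , ρ)
  ... | inj₁ _  | inj₂ _  | inj₁ ξ  | inj₁ η  = inj₁ (glue c₂∈ ξ η)
  ... | inj₁ _  | inj₂ ρ₁ | inj₁ _  | inj₂ ρ₂ = ⊥-elim (c₂≢c₁ (Y.rigid-w-unique ρ₂ ρ₁))

  blocked-unique : Blocked a b → Blocked a′ b′ → a ≡ a′ × b ≡ b′
  blocked-unique (_ , ρ) (_ , ρ′) = X.rigid-uv-unique ρ ρ′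

H1-colouring : (S : H1V → List ℤ) → a ∈ S hu → b ∈ S hv → (∀ i → Extension (S ∘ copy i) a b) →
               Σ (V H1 → ℤ) (IsProperListColouring H1 S)
H1-colouring {a = a} {b = b} S a∈ b∈ E = colour , colour∈ , proper
  where
  colour : H1V → ℤ
  colour hu = a
  colour hv = b
  colour (copy i z) = Extension.colour (E i) z

  colour∈ : ∀ z → colour z ∈ S z
  colour∈ hu = a∈
  colour∈ hv = b∈
  colour∈ (copy i z) = Extension.colour∈ (E i) z

  colour-emb : ∀ i s → colour (emb i s) ≡ extend a b (Extension.colour (E i)) s
  colour-emb i u = refl
  colour-emb i v = refl
  colour-emb i (inn z) = refl

  proper : ∀ x y → H1Adj x y → colour x ≢ colour y
  proper _ _ (i , s , t , st , refl , refl) =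
    subst₂ _≢_ (sym (colour-emb i s)) (sym (colour-emb i t)) (Extension.proper (E i) s t st)

element : IsKList 3 L → Fin 3 → ℤ
element {x ∷ _ ∷ _ ∷ []} _ zero = x
element {_ ∷ y ∷ _ ∷ []} _ (suc zero) = y
element {_ ∷ _ ∷ z ∷ []} _ (suc (suc zero)) = z

element-∈ : (three : IsKList 3 L) → ∀ i → element three i ∈ L
element-∈ {_ ∷ _ ∷ _ ∷ []} _ zero = here refl
element-∈ {_ ∷ _ ∷ _ ∷ []} _ (suc zero) = there (here refl)
element-∈ {_ ∷ _ ∷ _ ∷ []} _ (suc (suc zero)) = there (there (here refl))

element-injective : (three : IsKList 3 L) → Injective _≡_ _≡_ (element three)
element-injective {_ ∷ _ ∷ _ ∷ []} three@((x≢y ∷ x≢z ∷ []) ∷ (y≢z ∷ []) ∷ [] ∷ [] , refl) = injective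
  where
  injective : ∀ {i j} → element three i ≡ element three j → i ≡ j
  injective {zero}             {zero}             _ = refl
  injective {zero}             {suc zero}         e = ⊥-elim (x≢y e)
  injective {zero}             {suc (suc zero)}   e = ⊥-elim (x≢z e)
  injective {suc zero}         {zero}             e = ⊥-elim (x≢y (sym e))
  injective {suc zero}         {suc zero}         _ = refl
  injective {suc zero}         {suc (suc zero)}   e = ⊥-elim (y≢z e)
  injective {suc (suc zero)}   {zero}             e = ⊥-elim (x≢z (sym e))
  injective {suc (suc zero)}   {suc zero}         e = ⊥-elim (y≢z (sym e))
  injective {suc (suc zero)}   {suc (suc zero)}   _ = refl

all-or-some : ∀ n {A B : Fin n → Set} → (∀ i → A i ⊎ B i) → (∀ i → A i) ⊎ ∃ B
all-or-some zero    decide = inj₁ λ ()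
all-or-some (suc n) decide with decide zero | all-or-some n (decide ∘ suc)
... | inj₂ b | _            = inj₂ (zero , b)
... | inj₁ _ | inj₂ (i , b) = inj₂ (suc i , b)
... | inj₁ a | inj₁ as      = inj₁ λ { zero → a ; (suc i) → as i }

module _ (S : H1V → List ℤ) (three : ∀ z → IsKList 3 (S z)) where
  module W (i : Fin 6) = W₂ (S ∘ copy i) (three ∘ copy i)

  colour-u colour-v : Fin 9 → ℤ
  colour-u k = element (three hu) (proj₁ (remQuot {3} 3 k))
  colour-v k = element (three hv) (proj₂ (remQuot {3} 3 k))

  colour-uv-injective : ∀ {k k′} → colour-u k ≡ colour-u k′ → colour-v k ≡ colour-v k′ → k ≡ k′
  colour-uv-injective {k} {k′} same-u same-v = begin
    k                                  ≡⟨ sym (combine-remQuot {3} 3 k) ⟩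
    uncurry combine (remQuot {3} 3 k)  ≡⟨ cong (uncurry combine) same-remQuot ⟩
    uncurry combine (remQuot {3} 3 k′) ≡⟨ combine-remQuot {3} 3 k′ ⟩
    k′                                 ∎
    where
    open ≡-Reasoning
    same-remQuot : remQuot {3} 3 k ≡ remQuot {3} 3 k′
    same-remQuot = cong₂ _,_ (element-injective (three hu) same-u) (element-injective (three hv) same-v)

  Extends BlockedSomewhere : Fin 9 → Set
  Extends k = ∀ i → Extension (S ∘ copy i) (colour-u k) (colour-v k)
  BlockedSomewhere k = ∃ λ i → W.Blocked i (colour-u k) (colour-v k)

  -- Each copy of W₂ blocks at most one of the nine colour pairs for (u, v), and there are six copies.
  not-all-blocked : ¬ (∀ k → BlockedSomewhere k)
  not-all-blocked blocked = <⇒notInjective (from-yes (6 <? 9)) blocker-injective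
    where
    blocker-injective : Injective _≡_ _≡_ (proj₁ ∘ blocked)
    blocker-injective {k} {k′} same = uncurry colour-uv-injective
      (W.blocked-unique (proj₁ (blocked k)) (proj₂ (blocked k))
        (subst (λ i → W.Blocked i (colour-u k′) (colour-v k′)) (sym same) (proj₂ (blocked k′))))

  some-pair-extends : ∃ Extends
  some-pair-extends =
    [ ⊥-elim ∘ not-all-blocked , id ]′ (all-or-some 9 λ k → swap (all-or-some 6 λ i →
      W.extension-or-blocked i (colour-u k) (colour-v k)))

lemma4p4 : Choosable 3 H1
lemma4p4 S three =
  let k , extensions = some-pair-extends S three
  in H1-colouring S (element-∈ (three hu) _) (element-∈ (three hv) _) extensions
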